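{- Let $r\ge 2$ and let $k$ be a residue modulo $r$. Let $\mathcal{H}$ be an $n$-vertex $r$-graph containing no member of $\mathcal{C}_{\equiv k}^r\text{ - }\mathrm{hom}$, equipped with an accordant oriented coloring $\chi:\vec E(\mathcal{H})\to A_{\mathrm{cyc}^k}$, such that every color used in $\mathcal{H}$ is conjugate to $S_t\times S_{r-t}$ for some $t\in[r-1]$. Let $X,Y$ be two disjoint subsets of $V(\mathcal{H})$ with $|X|,|Y|\ge r$, and let $i\in[r-1]$. Suppose that for every set $W\subseteq X\cup Y$ with $|W\cap X| = i-1$ and $|W\cap Y| = r-i$, the number of vertices $v\in X\setminus W$ with $W\cup\{v\}\in E(\mathcal{H})$ is greater than $|X|/2$. Then the color $S_i\times S_{r-i}$ is used in $\mathcal{H}$, i.e. some edge of $\mathcal{H}$ is colored with a color conjugate to $S_i\times S_{r-i}$.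
   Context: An $r$-graph is an $r$-uniform hypergraph. $\mathcal{C}_\ell^r$ ($\ell>r$) is the tight cycle on $\{0,\ldots,\ell-1\}$ with edges $\{i,\ldots,i+r-1\}$ modulo $\ell$; $\mathcal{C}_{\equiv k}^r$ is the family of tight cycles with $\ell\equiv k\pmod r$; $\mathcal{F}\text{ - }\mathrm{hom}$ is the family of homomorphic images of members of $\mathcal{F}$ (images under edge-preserving vertex maps that are surjective on edges). An oriented edge is an ordered $r$-tuple $x_1\ldots x_r$ whose underlying set is an edge; $\vec E(\mathcal{H})$ is the set of oriented edges, with $S_r$ acting by $\pi(x_1\ldots x_r)=x_{\pi^{ -1}(1)}\ldots x_{\pi^{ -1}(r)}$. For $\Gamma\le S_r$, $S_r/\Gamma$ is the set of left cosets with $S_r$ acting by left multiplication. Let $\mathrm{cyc}=(1\,2\,\cdots\,r)$; let $\Gamma_1,\ldots,\Gamma_m$ be representatives of the conjugacy classes of maximal subgroups of $S_r$ containing no conjugate of $\mathrm{cyc}^k$, and $A_{\mathrm{cyc}^k}=\bigsqcup_j S_r/\Gamma_j$. An oriented coloring is a map $\chi:\vec E(\mathcal{H})\to A_{\mathrm{cyc}^k}$ with $\chi(\pi\vec x)=\pi\chi(\vec x)$; it is accordant if $\chi(\vec x)=\chi(\vec x')$ whenever $\vec x,\vec x'\in\vec E(\mathcal{H})$ differ in exactly one coordinate. An edge is colored with $\Gamma_j$ if $\chi$ of an (equivalently every) orientation of it lies in $S_r/\Gamma_j$; a color is used if some edge is colored with it. $S_t\times S_{r-t}$ denotes the subgroup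 of permutations preserving $\{1,\ldots,t\}$ and $\{t+1,\ldots,r\}$; note $S_t\times S_{r-t}$ and $S_{r-t}\times S_t$ are conjugate. -}

module Defs where

open import Data.Nat using (ℕ; zero; suc; _+_; _*_; _∸_; _≤_; _<_; _%_; NonZero; s≤s; z≤n)
open import Data.Nat.Base using (>-nonZero)
open import Data.Nat.Properties using (≤-trans)
open import Data.Nat.DivMod using (_mod_)
open import Data.Fin using (Fin; toℕ)
open import Data.Fin.Properties using (_≟_)
open import Data.Fin.Subset using (Subset; ⊥; ⁅_⁆; _∪_; _∩_; _─_; ∣_∣; _∈_; _∉_; _⊆_)
open import Data.Fin.Permutation using (Permutation′; _⟨$⟩ʳ_; _⟨$⟩ˡ_; id; flip; _∘ₚ_)
import Data.Fin.Permutation as P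
open import Data.Vec using (Vec; []; _∷_; lookup; tabulate)
open import Data.Bool using (Bool; T)
open import Data.Product using (Σ; ∃; ∃-syntax; _×_; _,_; proj₁)
open import Relation.Nullary using (¬_)
open import Relation.Binary.PropositionalEquality using (_≡_; _≢_)

Perm : ℕ → Set
Perm r = Permutation′ r

-- σ · τ  is the composite "first τ, then σ"
_·_ : ∀ {r} → Perm r → Perm r → Perm r
σ · τ = τ ∘ₚ σ

_⁻¹ : ∀ {r} → Perm r → Perm r
σ ⁻¹ = flip σ

record IsSubgroup {r : ℕ} (Γ : Perm r → Set) : Set where
  field
    resp : ∀ {σ τ} → σ P.≈ τ → Γ σ → Γ τ
    id∈  : Γ id
    ·∈   : ∀ {σ τ} → Γ σ → Γ τ → Γ (σ · τ)
    ⁻¹∈  : ∀ {σ} → Γ σ → Γ (σ ⁻¹)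

_⊆ₛ_ : ∀ {r} → (Perm r → Set) → (Perm r → Set) → Set
Γ ⊆ₛ Δ = ∀ σ → Γ σ → Δ σ

Conjugate : ∀ {r} → (Perm r → Set) → (Perm r → Set) → Set
Conjugate {r} Γ Δ = ∃[ σ ] (∀ π → (Γ π → Δ (σ · (π · (σ ⁻¹)))) × (Δ (σ · (π · (σ ⁻¹))) → Γ π))

-- cyc^k where cyc = (1 2 ⋯ r); 0-indexed: j ↦ j + k mod r
cycPow : ∀ r .{{_ : NonZero r}} → ℕ → Fin r → Fin r
cycPow r k j = (toℕ j + k) mod r

-- Γ contains a conjugate σ cyc^k σ⁻¹ of cyc^k (γ ∘ σ = σ ∘ cyc^k pointwise)
ContainsConjCycPow : ∀ r .{{_ : NonZero r}} → ℕ → (Perm r → Set) → Set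
ContainsConjCycPow r k Γ =
  ∃[ σ ] ∃[ γ ] (Γ γ × (∀ j → γ ⟨$⟩ʳ (σ ⟨$⟩ʳ j) ≡ σ ⟨$⟩ʳ cycPow r k j))

Avoiding : ∀ r .{{_ : NonZero r}} → ℕ → (Perm r → Set) → Set
Avoiding r k Γ = IsSubgroup Γ × ¬ ContainsConjCycPow r k Γ

MaximalAvoiding : ∀ r .{{_ : NonZero r}} → ℕ → (Perm r → Set) → Set₁
MaximalAvoiding r k Γ =
  Avoiding r k Γ × (∀ (Δ : Perm r → Set) → Avoiding r k Δ → Γ ⊆ₛ Δ → Δ ⊆ₛ Γ)

record Representatives (r : ℕ) .{{_ : NonZero r}} (k : ℕ) : Set₁ where
  field
    m        : ℕ
    Γ        : Fin m → Perm r → Set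
    maximal  : ∀ j → MaximalAvoiding r k (Γ j)
    distinct : ∀ j j′ → Conjugate (Γ j) (Γ j′) → j ≡ j′
    complete : ∀ (Δ : Perm r → Set) → MaximalAvoiding r k Δ → ∃[ j ] Conjugate Δ (Γ j)

module _ {r : ℕ} .{{_ : NonZero r}} {k : ℕ} (R : Representatives r k) where
  open Representatives R

  -- A_{cyc^k} = ⊔_j S_r/Γ_j : an element (j , σ) stands for the left coset σΓ_j
  Color : Set
  Color = Fin m × Perm r

  -- equality of colors: same j and σΓ_j = τΓ_j, i.e. σ⁻¹τ ∈ Γ_j
  _≈ᶜ_ : Color → Color → Set
  (j , σ) ≈ᶜ (j′ , τ) = (j ≡ j′) × Γ j ((σ ⁻¹) · τ)

  _•_ : Perm r → Color → Color
  π • (j , σ) = (j , π · σ)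

-- S_t × S_{r-t}: permutations preserving {0,…,t-1} and {t,…,r-1}
SymProd : ∀ {r} → ℕ → Perm r → Set
SymProd t π = ∀ a → (toℕ a < t → toℕ (π ⟨$⟩ʳ a) < t) × (t ≤ toℕ a → t ≤ toℕ (π ⟨$⟩ʳ a))

record Graph (r n : ℕ) : Set where
  field
    E       : Subset n → Bool
    uniform : ∀ e → T (E e) → ∣ e ∣ ≡ r

IsEdge : ∀ {r n} → Graph r n → Subset n → Set
IsEdge H e = T (Graph.E H e)

setOf : ∀ {n l} → Vec (Fin n) l → Subset n
setOf []      = ⊥
setOf (v ∷ x) = ⁅ v ⁆ ∪ setOf x

act : ∀ {r n} → Perm r → Vec (Fin n) r → Vec (Fin n) r
act π x = tabulate (λ j → lookup x (π ⟨$⟩ˡ j))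

DifferInOne : ∀ {r n} → Vec (Fin n) r → Vec (Fin n) r → Set
DifferInOne x x′ =
  ∃[ j ] (lookup x j ≢ lookup x′ j × (∀ j′ → j′ ≢ j → lookup x j′ ≡ lookup x′ j′))

cycIdx : ∀ {r} ℓ → r < ℓ → Fin ℓ → Fin r → Fin ℓ
cycIdx ℓ lt a b = _mod_ (toℕ a + toℕ b) ℓ {{>-nonZero (≤-trans (s≤s z≤n) lt)}}

-- f : V(C^r_ℓ) → V(H) maps every edge {a,…,a+r-1} of C^r_ℓ onto an edge of H,
-- i.e. H contains the homomorphic image f(C^r_ℓ)
IsCycleHom : ∀ {r n} → Graph r n → (ℓ : ℕ) → r < ℓ → (Fin ℓ → Fin n) → Set
IsCycleHom {r} H ℓ lt f = ∀ a → IsEdge H (setOf (tabulate {n = r} (λ b → f (cycIdx ℓ lt a b))))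

ContainsCycleHom : ∀ {r n} .{{_ : NonZero r}} → ℕ → Graph r n → Set
ContainsCycleHom {r} {n} k H =
  ∃[ ℓ ] Σ (r < ℓ) (λ lt → (ℓ % r ≡ k % r) × ∃[ f ] IsCycleHom H ℓ lt f)

module _ {r : ℕ} .{{_ : NonZero r}} {k : ℕ} (R : Representatives r k) {n : ℕ} (H : Graph r n) where

  Coloring : Set
  Coloring = (x : Vec (Fin n) r) → IsEdge H (setOf x) → Color R

  IsOrientedColoring : Coloring → Set
  IsOrientedColoring χ = ∀ π x p q → _≈ᶜ_ R (χ (act π x) q) (_•_ R π (χ x p))

  IsAccordant : Coloring → Set
  IsAccordant χ = ∀ x x′ p p′ → DifferInOne x x′ → _≈ᶜ_ R (χ x p) (χ x′ p′)

  Used : Coloring → Fin (Representatives.m R) → Set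
  Used χ j = ∃[ x ] Σ (IsEdge H (setOf x)) (λ p → proj₁ (χ x p) ≡ j)

extenders : ∀ {r n} → Graph r n → Subset n → Subset n
extenders H W = tabulate (λ v → Graph.E H (W ∪ ⁅ v ⁆))

{-# OPTIONS --safe #-}
-- Fix an edge x₀ = p ∷ g coloured (J , σ) whose first i entries lie in X and whose other entries lie
-- in Y.  Each such tail g has more than |X|/2 extensions in X, so two tails differing in one entry
-- have a common extension, and accordance gives all edges over both tails the same colour.  Chaining
-- these moves realises on x₀ the transpositions of the head with an X-position and (through a spare
-- vertex of Y) of two Y-positions, so orientation puts σ⁻¹πσ into Γ_J for each of them.  Being
-- conjugate to some S_t × S_{r−t}, Γ_J is the stabiliser of a proper nonempty set A of positions;
-- then σA is a union of the blocks {1,…,i} and {i+1,…,r}, hence one of them, and σΓ_Jσ⁻¹ = S_i × S_{r−i}.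
module Submission where

open import Defs
open import Data.Bool using (Bool; true; false; T; if_then_else_; _∧_)
open import Data.Bool.Properties using (T-irrelevant; T-≡; ¬-not) renaming (_≟_ to _≟ᵇ_)
open import Data.Fin using (Fin; zero; suc; toℕ; fromℕ<)
open import Data.Fin.Properties using (_≟_; suc-injective; toℕ-fromℕ<; 0≢1+n)
open import Data.Fin.Permutation using (_⟨$⟩ʳ_; _⟨$⟩ˡ_; inverseˡ; inverseʳ; transpose)
import Data.Fin.Permutation.Components as PC
open import Data.Fin.Subset
  using (Subset; ⊥; ⁅_⁆; _∪_; _∩_; _─_; ∣_∣; _∈_; _∉_; _⊆_; Nonempty; inside; outside)
open import Data.Fin.Subset.Properties
  using ( ∉⊥; ∣⊥∣≡0; ∩-zeroˡ; x∈⁅x⁆; x∈⁅y⁆⇒x≡y; ∪-identityˡ; ∪-comm; x∈p∪q⁺; x∈p∪q⁻; x∈p∩q⁻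
        ; p∩q⊆p; p∩q⊆q; p─q⊆p; p⊆q⇒∣p∣≤∣q∣; ⊆-antisym)
open import Data.Nat using (ℕ; zero; suc; _+_; _*_; _∸_; _≤_; _<_; _<ᵇ_; s≤s; z≤n; NonZero)
open import Data.Nat.Properties
  using ( <⇒<ᵇ; <ᵇ-reflects-<; ≤⇒≯; ≮⇒≥; <-irrefl; <⇒≤; ≤-trans; n≤1+n; +-suc; +-identityʳ; +-mono-<
        ; *-distribˡ-+; +-cancelˡ-<; *-cancelˡ-<; module ≤-Reasoning)
open import Data.Product using (∃₂; ∃-syntax; Σ; _×_; _,_; proj₁; proj₂)
open import Data.Sum using (_⊎_; inj₁; inj₂; [_,_])
open import Data.Unit using (tt)
open import Data.Vec using (Vec; []; _∷_; lookup; tabulate; _[_]≔_; here; there)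
open import Data.Vec.Properties using (lookup∘tabulate; lookup∘update; lookup∘update′; []=⇒lookup)
open import Data.Vec.Relation.Binary.Pointwise.Extensional using (ext; Pointwise-≡⇒≡)
open import Function using (_∘_; _⇔_; mk⇔; Equivalence; Injective)
open import Function.Properties.Equivalence using () renaming (trans to ⇔-trans; sym to ⇔-sym)
open import Relation.Nullary using (¬_; yes; no; contradiction)
open import Relation.Nullary.Reflects using (Reflects; ofʸ; ofⁿ)
open import Relation.Binary.PropositionalEquality
  using (_≡_; _≢_; refl; sym; trans; cong; subst; subst₂; ≢-sym; module ≡-Reasoning)

module _ {r : ℕ} where

  Preserves : (Fin r → Bool) → Perm r → Set
  Preserves A π = ∀ a → A (π ⟨$⟩ʳ a) ≡ A a

  conj : Perm r → Perm r → Perm r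
  conj σ π = σ · (π · (σ ⁻¹))

  preserves-conj : ∀ A σ π → Preserves A (conj σ π) ⇔ Preserves (A ∘ (σ ⟨$⟩ʳ_)) π
  preserves-conj A σ π = mk⇔
    (λ p a → subst (λ b → A (σ ⟨$⟩ʳ (π ⟨$⟩ʳ b)) ≡ A (σ ⟨$⟩ʳ a)) (inverseˡ σ) (p (σ ⟨$⟩ʳ a)))
    (λ p b → trans (p (σ ⟨$⟩ˡ b)) (cong A (inverseʳ σ)))

  preserves-≗ : ∀ {A B π} → (∀ a → A a ≡ B a) → Preserves A π → Preserves B π
  preserves-≗ {π = π} A≗B p a = trans (sym (A≗B (π ⟨$⟩ʳ a))) (trans (p a) (A≗B a))

  Refines : (Fin r → Bool) → (Fin r → Bool) → Set
  Refines A B = ∀ x y → A x ≡ A y → B x ≡ B y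

  preserves-refines : ∀ {A B π} → Refines A B → Preserves A π → Preserves B π
  preserves-refines {π = π} A⊑B p a = A⊑B (π ⟨$⟩ʳ a) a (p a)

  Nonconstant : (Fin r → Bool) → Set
  Nonconstant A = ∃₂ λ a b → A a ≢ A b

  nonconstant-∘ : ∀ {A} σ → Nonconstant A → Nonconstant (A ∘ (σ ⟨$⟩ˡ_))
  nonconstant-∘ {A} σ (a , b , Aa≢Ab) =
    σ ⟨$⟩ʳ a , σ ⟨$⟩ʳ b , λ e → Aa≢Ab (subst₂ (λ x y → A x ≡ A y) (inverseˡ σ) (inverseˡ σ) e)

  refines-converse : ∀ {P A} → Refines P A → Nonconstant A → Refines A P
  refines-converse {P} {A} P⊑A (a , b , Aa≢Ab) x y Ax≡Ay with P x ≟ᵇ P y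
  ... | yes Px≡Py = Px≡Py
  ... | no Px≢Py = contradiction (trans (constant a) (sym (constant b))) Aa≢Ab
    where
    -- P is Boolean: if it separates x from y, every z shares its P-value with x or with y.
    constant : ∀ z → A z ≡ A x
    constant z with P z ≟ᵇ P x
    ... | yes Pz≡Px = P⊑A z x Pz≡Px
    ... | no Pz≢Px = trans (P⊑A z y (trans (¬-not Pz≢Px) (sym (¬-not (≢-sym Px≢Py))))) (sym Ax≡Ay)

  transpose-matchˡ : ∀ (i j : Fin r) → PC.transpose i j i ≡ j
  transpose-matchˡ i j with i ≟ i
  ... | yes _ = refl
  ... | no i≢i = contradiction refl i≢i

  preserves-transpose : ∀ {A} i j → Preserves A (transpose i j) → A j ≡ A i
  preserves-transpose {A} i j p = subst (λ k → A k ≡ A i) (transpose-matchˡ i j) (p i)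

  below : ℕ → Fin r → Bool
  below t a = toℕ a <ᵇ t

  below-reflects : ∀ t a → Reflects (toℕ a < t) (below t a)
  below-reflects t a = <ᵇ-reflects-< (toℕ a) t

  below-true : ∀ {t a} → toℕ a < t → below t a ≡ true
  below-true a<t = Equivalence.to T-≡ (<⇒<ᵇ a<t)

  below-false : ∀ {t a} → ¬ toℕ a < t → below t a ≡ false
  below-false {t} {a} a≮t with below t a | below-reflects t a
  ... | false | _       = refl
  ... | true  | ofʸ a<t = contradiction a<t a≮t

  below-fromℕ< : ∀ {t} (t<r : t < r) → below t (fromℕ< t<r) ≡ false
  below-fromℕ< t<r = below-false (<-irrefl (toℕ-fromℕ< t<r))

  symProd⇔preserves-below : ∀ t π → SymProd t π ⇔ Preserves (below t) π
  symProd⇔preserves-below t π = mk⇔ to from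
    where
    to : SymProd t π → Preserves (below t) π
    to sp a with below t a | below-reflects t a | below t (π ⟨$⟩ʳ a) | below-reflects t (π ⟨$⟩ʳ a)
    ... | true  | _         | true  | _          = refl
    ... | true  | ofʸ a<t   | false | ofⁿ πa≮t   = contradiction (proj₁ (sp a) a<t) πa≮t
    ... | false | ofⁿ a≮t   | true  | ofʸ πa<t   = contradiction πa<t (≤⇒≯ (proj₂ (sp a) (≮⇒≥ a≮t)))
    ... | false | _         | false | _          = refl
    from : Preserves (below t) π → SymProd t π
    from p a with below t a | below-reflects t a | below t (π ⟨$⟩ʳ a) | below-reflects t (π ⟨$⟩ʳ a) | p a
    ... | true  | ofʸ a<t | true  | ofʸ πa<t | _ = (λ _ → πa<t) , λ t≤a → contradiction a<t (≤⇒≯ t≤a)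
    ... | false | ofⁿ a≮t | false | ofⁿ πa≮t | _ = (λ a<t → contradiction a<t a≮t) , λ _ → ≮⇒≥ πa≮t
    ... | true  | _       | false | _        | ()
    ... | false | _       | true  | _        | ()

  preserves⇔symProd : ∀ {t B} → Refines (below t) B → Nonconstant B → ∀ ρ → Preserves B ρ ⇔ SymProd t ρ
  preserves⇔symProd {t} {B} below⊑B B-nonconstant ρ = ⇔-trans
    (mk⇔ (preserves-refines {B} {below t} {ρ} (refines-converse {below t} {B} below⊑B B-nonconstant))
         (preserves-refines {below t} {B} {ρ} below⊑B))
    (⇔-sym (symProd⇔preserves-below t ρ))

  stabiliser-conjugate : ∀ {t} {Γ : Perm r → Set} A σ → (∀ π → Γ π ⇔ Preserves A π)
    → (∀ ρ → Preserves (A ∘ (σ ⟨$⟩ˡ_)) ρ ⇔ SymProd t ρ) → Conjugate Γ (SymProd t)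
  stabiliser-conjugate {t} {Γ} A σ Γ⇔A B⇔SymProd =
    σ , λ π → Equivalence.to (chain π) , Equivalence.from (chain π)
    where
    cancel : ∀ a → A a ≡ A (σ ⟨$⟩ˡ (σ ⟨$⟩ʳ a))
    cancel a = cong A (sym (inverseˡ σ))
    chain : ∀ π → Γ π ⇔ SymProd t (conj σ π)
    chain π = ⇔-trans (Γ⇔A π)
      (⇔-trans (mk⇔ (preserves-≗ {A} {π = π} cancel) (preserves-≗ {B = A} {π} (sym ∘ cancel)))
        (⇔-trans (⇔-sym (preserves-conj (A ∘ (σ ⟨$⟩ˡ_)) σ π)) (B⇔SymProd (conj σ π))))

below-nonconstant : ∀ {m t} → 1 ≤ t → t < suc m → Nonconstant (below {suc m} t)
below-nonconstant {m} {t} 1≤t t<r = zero , fromℕ< t<r ,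
  λ e → contradiction (trans (sym (below-true {suc m} {t} {zero} 1≤t)) (trans e (below-fromℕ< t<r))) λ ()

conjugate-symProd⇒stabiliser : ∀ {m t} {Γ : Perm (suc m) → Set} → 1 ≤ t → t < suc m → Conjugate Γ (SymProd t)
  → ∃[ A ] (Nonconstant A × ∀ π → Γ π ⇔ Preserves A π)
conjugate-symProd⇒stabiliser {t = t} 1≤t t<r (τ , Γ~) =
  below t ∘ (τ ⟨$⟩ʳ_) , nonconstant-∘ (τ ⁻¹) (below-nonconstant 1≤t t<r) ,
  λ π → ⇔-trans (mk⇔ (proj₁ (Γ~ π)) (proj₂ (Γ~ π)))
          (⇔-trans (symProd⇔preserves-below t (conj τ π)) (preserves-conj (below t) τ π))

blockwise-constant⇒refines : ∀ {m} c (y : Fin m) {B : Fin (suc m) → Bool}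
  → (∀ b → below c b ≡ true → B (suc b) ≡ B zero)
  → (∀ b → below c b ≡ false → B (suc b) ≡ B (suc y))
  → Refines (below (suc c)) B
blockwise-constant⇒refines {m} c y {B} X-block Y-block x x′ same-block =
  trans (to-representative x) (trans (cong (B ∘ representative) same-block) (sym (to-representative x′)))
  where
  representative : Bool → Fin (suc m)
  representative true  = zero
  representative false = suc y
  on-suc : ∀ b β → below c b ≡ β → B (suc b) ≡ B (representative β)
  on-suc b true  = X-block b
  on-suc b false = Y-block b
  to-representative : ∀ x → B x ≡ B (representative (below (suc c) x))
  to-representative zero    = refl
  to-representative (suc b) = on-suc b (below c b) refl

∣∷∣-+ : ∀ {n} k b (p q : Subset n) → ∣ p ∣ ≡ k + ∣ q ∣ → ∣ b ∷ p ∣ ≡ k + ∣ b ∷ q ∣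
∣∷∣-+ k inside  _ q e = trans (cong suc e) (sym (+-suc k ∣ q ∣))
∣∷∣-+ k outside _ _ e = e

x∈q⇒∣⁅x⁆∪p∩q∣≡1+∣p∩q∣ : ∀ {n} {x : Fin n} (p q : Subset n) → x ∈ q → x ∉ p
  → ∣ (⁅ x ⁆ ∪ p) ∩ q ∣ ≡ suc ∣ p ∩ q ∣
x∈q⇒∣⁅x⁆∪p∩q∣≡1+∣p∩q∣ {x = zero} (inside ∷ p) _ _ x∉p = contradiction here x∉p
x∈q⇒∣⁅x⁆∪p∩q∣≡1+∣p∩q∣ {x = zero} (outside ∷ p) (inside ∷ q) _ _ = cong (λ s → suc ∣ s ∩ q ∣) (∪-identityˡ p)
x∈q⇒∣⁅x⁆∪p∩q∣≡1+∣p∩q∣ {x = suc x} (s ∷ p) (t ∷ q) (there x∈q) x∉p =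
  ∣∷∣-+ 1 (s ∧ t) ((⁅ x ⁆ ∪ p) ∩ q) (p ∩ q) (x∈q⇒∣⁅x⁆∪p∩q∣≡1+∣p∩q∣ p q x∈q (x∉p ∘ there))

x∉q⇒∣⁅x⁆∪p∩q∣≡∣p∩q∣ : ∀ {n} {x : Fin n} (p q : Subset n) → x ∉ q → ∣ (⁅ x ⁆ ∪ p) ∩ q ∣ ≡ ∣ p ∩ q ∣
x∉q⇒∣⁅x⁆∪p∩q∣≡∣p∩q∣ {x = zero} _ (inside ∷ q) x∉q = contradiction here x∉q
x∉q⇒∣⁅x⁆∪p∩q∣≡∣p∩q∣ {x = zero} (inside ∷ p) (outside ∷ q) _ = cong (λ s → ∣ s ∩ q ∣) (∪-identityˡ p)
x∉q⇒∣⁅x⁆∪p∩q∣≡∣p∩q∣ {x = zero} (outside ∷ p) (outside ∷ q) _ = cong (λ s → ∣ s ∩ q ∣) (∪-identityˡ p)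
x∉q⇒∣⁅x⁆∪p∩q∣≡∣p∩q∣ {x = suc x} (s ∷ p) (t ∷ q) x∉q =
  ∣∷∣-+ 0 (s ∧ t) ((⁅ x ⁆ ∪ p) ∩ q) (p ∩ q) (x∉q⇒∣⁅x⁆∪p∩q∣≡∣p∩q∣ p q (x∉q ∘ there))

∣p∣+∣q∣≡∣p∪q∣+∣p∩q∣ : ∀ {n} (p q : Subset n) → ∣ p ∣ + ∣ q ∣ ≡ ∣ p ∪ q ∣ + ∣ p ∩ q ∣
∣p∣+∣q∣≡∣p∪q∣+∣p∩q∣ [] [] = refl
∣p∣+∣q∣≡∣p∪q∣+∣p∩q∣ (outside ∷ p) (outside ∷ q) = ∣p∣+∣q∣≡∣p∪q∣+∣p∩q∣ p q
∣p∣+∣q∣≡∣p∪q∣+∣p∩q∣ (inside ∷ p) (outside ∷ q) = cong suc (∣p∣+∣q∣≡∣p∪q∣+∣p∩q∣ p q)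
∣p∣+∣q∣≡∣p∪q∣+∣p∩q∣ (outside ∷ p) (inside ∷ q) =
  trans (+-suc ∣ p ∣ ∣ q ∣) (cong suc (∣p∣+∣q∣≡∣p∪q∣+∣p∩q∣ p q))
∣p∣+∣q∣≡∣p∪q∣+∣p∩q∣ (inside ∷ p) (inside ∷ q) = cong suc (begin
  ∣ p ∣ + suc ∣ q ∣              ≡⟨ +-suc ∣ p ∣ ∣ q ∣ ⟩
  suc (∣ p ∣ + ∣ q ∣)            ≡⟨ cong suc (∣p∣+∣q∣≡∣p∪q∣+∣p∩q∣ p q) ⟩
  suc (∣ p ∪ q ∣ + ∣ p ∩ q ∣)    ≡⟨ +-suc ∣ p ∪ q ∣ ∣ p ∩ q ∣ ⟨
  ∣ p ∪ q ∣ + suc ∣ p ∩ q ∣      ∎)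
  where open ≡-Reasoning

∣p∣>0⇒nonempty : ∀ {n} (p : Subset n) → 0 < ∣ p ∣ → Nonempty p
∣p∣>0⇒nonempty (inside ∷ p) _ = zero , here
∣p∣>0⇒nonempty (outside ∷ p) 0<∣p∣ with ∣p∣>0⇒nonempty p 0<∣p∣
... | x , x∈p = suc x , there x∈p

x∈p─q⇒x∉q : ∀ {n} {x : Fin n} (p q : Subset n) → x ∈ p ─ q → x ∉ q
x∈p─q⇒x∉q (_ ∷ p) (inside ∷ q) () here
x∈p─q⇒x∉q (_ ∷ p) (_ ∷ q) (there x∈p─q) (there x∈q) = x∈p─q⇒x∉q p q x∈p─q x∈q

<2*⇒<+ : ∀ {s a b} → s < 2 * a → s < 2 * b → s < a + b
<2*⇒<+ {s} {a} {b} s<2a s<2b = *-cancelˡ-< 2 s (a + b) (begin-strict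
  2 * s          ≡⟨ cong (s +_) (+-identityʳ s) ⟩
  s + s          <⟨ +-mono-< s<2a s<2b ⟩
  2 * a + 2 * b  ≡⟨ *-distribˡ-+ 2 a b ⟨
  2 * (a + b)    ∎)
  where open ≤-Reasoning

majorities-meet : ∀ {n} {S A B : Subset n} → A ⊆ S → B ⊆ S → ∣ S ∣ < 2 * ∣ A ∣ → ∣ S ∣ < 2 * ∣ B ∣
  → Nonempty (A ∩ B)
majorities-meet {S = S} {A} {B} A⊆S B⊆S big-A big-B =
  ∣p∣>0⇒nonempty (A ∩ B) (+-cancelˡ-< _ 0 _ (begin-strict
    ∣ A ∪ B ∣ + 0           ≡⟨ +-identityʳ _ ⟩
    ∣ A ∪ B ∣               ≤⟨ p⊆q⇒∣p∣≤∣q∣ (λ x∈A∪B → [ A⊆S , B⊆S ] (x∈p∪q⁻ A B x∈A∪B)) ⟩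
    ∣ S ∣                   <⟨ <2*⇒<+ {∣ S ∣} {∣ A ∣} {∣ B ∣} big-A big-B ⟩
    ∣ A ∣ + ∣ B ∣           ≡⟨ ∣p∣+∣q∣≡∣p∪q∣+∣p∩q∣ A B ⟩
    ∣ A ∪ B ∣ + ∣ A ∩ B ∣   ∎))
  where open ≤-Reasoning

lookup-update : ∀ {A : Set} {l} (g : Vec A l) i v q
  → (q ≡ i × lookup (g [ i ]≔ v) q ≡ v) ⊎ (q ≢ i × lookup (g [ i ]≔ v) q ≡ lookup g q)
lookup-update g i v q with q ≟ i
... | yes refl = inj₁ (refl , lookup∘update q g v)
... | no q≢i   = inj₂ (q≢i , lookup∘update′ q≢i g v)

Distinct : ∀ {n l} → Vec (Fin n) l → Set
Distinct g = Injective _≡_ _≡_ (lookup g)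

module _ {n : ℕ} where

  ∈setOf⁺ : ∀ {l} (x : Vec (Fin n) l) q → lookup x q ∈ setOf x
  ∈setOf⁺ (u ∷ x) zero    = x∈p∪q⁺ (inj₁ (x∈⁅x⁆ u))
  ∈setOf⁺ (u ∷ x) (suc q) = x∈p∪q⁺ (inj₂ (∈setOf⁺ x q))

  ∈setOf⁻ : ∀ {l} (x : Vec (Fin n) l) {v} → v ∈ setOf x → ∃[ q ] lookup x q ≡ v
  ∈setOf⁻ []      v∈ = contradiction v∈ ∉⊥
  ∈setOf⁻ (u ∷ x) v∈ with x∈p∪q⁻ ⁅ u ⁆ (setOf x) v∈
  ... | inj₁ v∈⁅u⁆ = zero , sym (x∈⁅y⁆⇒x≡y u v∈⁅u⁆)
  ... | inj₂ v∈x with ∈setOf⁻ x v∈x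
  ...   | q , e = suc q , e

  ∉setOf⇒≢ : ∀ {l} (x : Vec (Fin n) l) {v} → v ∉ setOf x → ∀ q → lookup x q ≢ v
  ∉setOf⇒≢ x v∉x q e = v∉x (subst (_∈ setOf x) e (∈setOf⁺ x q))

  head-new : ∀ {l u} {g : Vec (Fin n) l} → Distinct (u ∷ g) → u ∉ setOf g
  head-new {g = g} distinct u∈g with ∈setOf⁻ g u∈g
  ... | q , e = 0≢1+n (sym (distinct e))

  setOf-act : ∀ {r} (π : Perm r) (x : Vec (Fin n) r) → setOf (act π x) ≡ setOf x
  setOf-act π x = ⊆-antisym ⊆x x⊆
    where
    ⊆x : setOf (act π x) ⊆ setOf x
    ⊆x v∈ with ∈setOf⁻ (act π x) v∈
    ... | q , refl = subst (_∈ setOf x) (sym (lookup∘tabulate _ q)) (∈setOf⁺ x (π ⟨$⟩ˡ q))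
    x⊆ : setOf x ⊆ setOf (act π x)
    x⊆ v∈ with ∈setOf⁻ x v∈
    ... | q , refl = subst (_∈ setOf (act π x))
                       (trans (lookup∘tabulate _ (π ⟨$⟩ʳ q)) (cong (lookup x) (inverseˡ π)))
                       (∈setOf⁺ (act π x) (π ⟨$⟩ʳ q))

  act-transpose : ∀ {r} (x y : Vec (Fin n) r) i j → lookup y i ≡ lookup x j → lookup y j ≡ lookup x i
    → (∀ k → k ≢ i → k ≢ j → lookup y k ≡ lookup x k) → act (transpose i j) x ≡ y
  act-transpose x y i j yi yj yk = Pointwise-≡⇒≡ (ext λ k → trans (lookup∘tabulate _ k) (swapped k))
    where
    swapped : ∀ k → lookup x (PC.transpose j i k) ≡ lookup y k
    swapped k with k ≟ j
    ... | yes refl = sym yj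
    ... | no k≢j with k ≟ i
    ...   | yes refl = sym yi
    ...   | no k≢i   = sym (yk k k≢i k≢j)

  act-transpose-head : ∀ {m} (p : Fin n) (g : Vec (Fin n) m) b
    → act (transpose zero (suc b)) (p ∷ g) ≡ lookup g b ∷ (g [ b ]≔ p)
  act-transpose-head p g b = act-transpose (p ∷ g) _ zero (suc b) refl (lookup∘update b g p) others
    where
    others : ∀ k → k ≢ zero → k ≢ suc b → lookup (lookup g b ∷ (g [ b ]≔ p)) k ≡ lookup (p ∷ g) k
    others zero    0≢0 _     = contradiction refl 0≢0
    others (suc q) _   q≢b   = lookup∘update′ (q≢b ∘ cong suc) g p

  act-transpose-tail : ∀ {m} (p z : Fin n) (g : Vec (Fin n) m) a b
    → act (transpose (suc a) (suc b)) (p ∷ g) ≡ p ∷ ((g [ a ]≔ z) [ b ]≔ lookup g a) [ a ]≔ lookup g b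
  act-transpose-tail p z g a b =
    act-transpose (p ∷ g) (p ∷ g₃) (suc a) (suc b) (lookup∘update a g₂ (lookup g b)) g₃-at-b others
    where
    g₁ = g [ a ]≔ z
    g₂ = g₁ [ b ]≔ lookup g a
    g₃ = g₂ [ a ]≔ lookup g b
    g₃-at-b : lookup g₃ b ≡ lookup g a
    g₃-at-b with lookup-update g₂ a (lookup g b) b
    ... | inj₁ (refl , e) = e
    ... | inj₂ (_ , e)    = trans e (lookup∘update b g₁ (lookup g a))
    others : ∀ k → k ≢ suc a → k ≢ suc b → lookup (p ∷ g₃) k ≡ lookup (p ∷ g) k
    others zero    _   _   = refl
    others (suc q) q≢a q≢b = trans (lookup∘update′ (q≢a ∘ cong suc) g₂ _)
      (trans (lookup∘update′ (q≢b ∘ cong suc) g₁ _) (lookup∘update′ (q≢a ∘ cong suc) g z))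

embedding : ∀ {n} (S : Subset n) k → k ≤ ∣ S ∣ → Σ (Fin k → Fin n) λ f → Injective _≡_ _≡_ f × (∀ q → f q ∈ S)
embedding S zero _ = (λ ()) , (λ { {()} }) , λ ()
embedding (inside ∷ S) (suc k) (s≤s k≤∣S∣) with embedding S k k≤∣S∣
... | f , f-injective , f∈S = f′ , f′-injective , f′∈S
  where
  f′ : Fin (suc k) → Fin (suc _)
  f′ zero    = zero
  f′ (suc q) = suc (f q)
  f′-injective : Injective _≡_ _≡_ f′
  f′-injective {zero}  {zero}  _ = refl
  f′-injective {suc p} {suc q} e = cong suc (f-injective (suc-injective e))
  f′∈S : ∀ q → f′ q ∈ inside ∷ S
  f′∈S zero    = here
  f′∈S (suc q) = there (f∈S q)
embedding (outside ∷ S) k k≤∣S∣ with embedding S k k≤∣S∣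
... | f , f-injective , f∈S = suc ∘ f , f-injective ∘ suc-injective , there ∘ f∈S

module Admissibility {n : ℕ} (X Y : Subset n) (disjoint : ∀ v → v ∈ X → v ∉ Y) where

  -- An admissible tuple orders a set W as in the hypothesis of the theorem: the entries at positions
  -- below c (= i − 1) lie in X, the others in Y.
  side : ∀ {l} → ℕ → Fin l → Subset n
  side c q = if below c q then X else Y

  record Admissible {l} (c : ℕ) (g : Vec (Fin n) l) : Set where
    constructor admissible
    field
      distinct : Distinct g
      sides    : ∀ q → lookup g q ∈ side c q

  side-below : ∀ {l} c (q : Fin l) → below c q ≡ true → side c q ≡ X
  side-below _ _ = cong (if_then X else Y)

  side-above : ∀ {l} c (q : Fin l) → below c q ≡ false → side c q ≡ Y
  side-above _ _ = cong (if_then X else Y)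

  side⊆X∪Y : ∀ {l c} (q : Fin l) → side c q ⊆ X ∪ Y
  side⊆X∪Y {c = c} q with below c q
  ... | true  = x∈p∪q⁺ ∘ inj₁
  ... | false = x∈p∪q⁺ ∘ inj₂

  admissible-⊆ : ∀ {l c} {g : Vec (Fin n) l} → Admissible c g → setOf g ⊆ X ∪ Y
  admissible-⊆ {c = c} {g} (admissible _ sides) v∈g with ∈setOf⁻ g v∈g
  ... | q , refl = side⊆X∪Y {c = c} q (sides q)

  admissible-tail : ∀ {l} c {u} {g : Vec (Fin n) l} → Admissible c (u ∷ g) → Admissible (c ∸ 1) g
  admissible-tail zero {g = g} (admissible distinct sides) = admissible (suc-injective ∘ distinct)
    λ q → subst (lookup g q ∈_) (sym (side-above 0 q (below-false {t = 0} {a = q} λ ()))) (sides (suc q))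
  admissible-tail (suc c) (admissible distinct sides) = admissible (suc-injective ∘ distinct) (sides ∘ suc)

  admissible-counts : ∀ {l} c (g : Vec (Fin n) l) → Admissible c g → c ≤ l
    → ∣ setOf g ∩ X ∣ ≡ c × ∣ setOf g ∩ Y ∣ ≡ l ∸ c
  admissible-counts _ [] _ z≤n = ∣⊥∩∣≡0 X , ∣⊥∩∣≡0 Y
    where
    ∣⊥∩∣≡0 : ∀ S → ∣ ⊥ ∩ S ∣ ≡ 0
    ∣⊥∩∣≡0 S = trans (cong ∣_∣ (∩-zeroˡ S)) (∣⊥∣≡0 n)
  admissible-counts zero (u ∷ g) adm@(admissible distinct sides) _ =
    trans (x∉q⇒∣⁅x⁆∪p∩q∣≡∣p∩q∣ _ X (λ u∈X → disjoint u u∈X (sides zero))) (proj₁ counts) ,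
    trans (x∈q⇒∣⁅x⁆∪p∩q∣≡1+∣p∩q∣ _ Y (sides zero) (head-new distinct)) (cong suc (proj₂ counts))
    where counts = admissible-counts zero g (admissible-tail zero adm) z≤n
  admissible-counts (suc c) (u ∷ g) adm@(admissible distinct sides) (s≤s c≤l) =
    trans (x∈q⇒∣⁅x⁆∪p∩q∣≡1+∣p∩q∣ _ X (sides zero) (head-new distinct)) (cong suc (proj₁ counts)) ,
    trans (x∉q⇒∣⁅x⁆∪p∩q∣≡∣p∩q∣ _ Y (disjoint u (sides zero))) (proj₂ counts)
    where counts = admissible-counts c g (admissible-tail (suc c) adm) c≤l

  admissible-update : ∀ {l c} {g : Vec (Fin n) l} {a v} → Admissible c g → v ∈ side c a
    → (∀ q → q ≢ a → lookup g q ≢ v) → Admissible c (g [ a ]≔ v)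
  admissible-update {c = c} {g} {a} {v} (admissible distinct sides) v∈ v-new = admissible distinct′ sides′
    where
    distinct′ : Distinct (g [ a ]≔ v)
    distinct′ {p} {q} e with lookup-update g a v p | lookup-update g a v q
    ... | inj₁ (refl , _)  | inj₁ (refl , _)  = refl
    ... | inj₁ (refl , e₁) | inj₂ (q≢a , e₂) = contradiction (trans (sym e₂) (trans (sym e) e₁)) (v-new q q≢a)
    ... | inj₂ (p≢a , e₁) | inj₁ (refl , e₂) = contradiction (trans (sym e₁) (trans e e₂)) (v-new p p≢a)
    ... | inj₂ (_ , e₁)    | inj₂ (_ , e₂)    = distinct (trans (sym e₁) (trans e e₂))
    sides′ : ∀ q → lookup (g [ a ]≔ v) q ∈ side c q
    sides′ q with lookup-update g a v q
    ... | inj₁ (refl , e) = subst (_∈ side c q) (sym e) v∈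
    ... | inj₂ (_ , e)    = subst (_∈ side c q) (sym e) (sides q)

∈extenders⇒edge : ∀ {r n} (H : Graph r n) {W v} → v ∈ extenders H W → IsEdge H (W ∪ ⁅ v ⁆)
∈extenders⇒edge H {v = v} v∈ = subst T (sym (trans (sym (lookup∘tabulate _ v)) ([]=⇒lookup v∈))) tt

module Extensions {m n : ℕ} (H : Graph (suc m) n) (X Y : Subset n) (disjoint : ∀ v → v ∈ X → v ∉ Y)
  (c : ℕ) (c≤m : c ≤ m)
  (majority : ∀ W → W ⊆ X ∪ Y → ∣ W ∩ X ∣ ≡ c → ∣ W ∩ Y ∣ ≡ m ∸ c
            → ∣ X ∣ < 2 * ∣ (X ─ W) ∩ extenders H W ∣) where

  open Admissibility X Y disjoint public

  extensions : Vec (Fin n) m → Subset n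
  extensions g = (X ─ setOf g) ∩ extenders H (setOf g)

  extensions⊆X : ∀ g → extensions g ⊆ X
  extensions⊆X g = p─q⊆p X (setOf g) ∘ p∩q⊆p _ _

  extension-new : ∀ g {v} → v ∈ extensions g → v ∉ setOf g
  extension-new g = x∈p─q⇒x∉q X (setOf g) ∘ p∩q⊆p _ _

  extension-edge : ∀ g {v} → v ∈ extensions g → IsEdge H (setOf (v ∷ g))
  extension-edge g {v} v∈ =
    subst (IsEdge H) (∪-comm (setOf g) ⁅ v ⁆) (∈extenders⇒edge H (p∩q⊆q _ _ v∈))

  many-extensions : ∀ {g} → Admissible c g → ∣ X ∣ < 2 * ∣ extensions g ∣
  many-extensions {g} adm =
    let X-count , Y-count = admissible-counts c g adm c≤m
    in majority (setOf g) (admissible-⊆ adm) X-count Y-count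

  common-extension : ∀ {g g′} → Admissible c g → Admissible c g′
    → ∃[ v ] (v ∈ extensions g × v ∈ extensions g′)
  common-extension {g} {g′} adm adm′ =
    let v , v∈ = majorities-meet (extensions⊆X g) (extensions⊆X g′)
                                 (many-extensions adm) (many-extensions adm′)
    in v , x∈p∩q⁻ _ _ v∈

  extension : ∀ {g} → Admissible c g → ∃[ v ] v ∈ extensions g
  extension adm = let v , v∈ , _ = common-extension adm adm in v , v∈

  record Base : Set where
    field
      tail            : Vec (Fin n) m
      tail-admissible : Admissible c tail
      head            : Fin n
      extends         : head ∈ extensions tail
      spare           : Fin n
      spare∈Y         : spare ∈ Y
      spare-new       : spare ∉ setOf tail

  base : m ≤ ∣ X ∣ → suc m ≤ ∣ Y ∣ → Base
  base m≤∣X∣ r≤∣Y∣ with embedding X m m≤∣X∣ | embedding Y (suc m) r≤∣Y∣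
  ... | fX , fX-injective , fX∈X | fY , fY-injective , fY∈Y = record
    { tail = tail₀ ; tail-admissible = admissible₀
    ; head = proj₁ (extension admissible₀) ; extends = proj₂ (extension admissible₀)
    ; spare = fY zero ; spare∈Y = fY∈Y zero ; spare-new = spare-new₀ }
    where
    pick : Fin m → Fin n
    pick q = if below c q then fX q else fY (suc q)
    pick-injective : Injective _≡_ _≡_ pick
    pick-injective {p} {q} e with below c p | below c q
    ... | true  | true  = fX-injective e
    ... | true  | false = contradiction (subst (_∈ Y) (sym e) (fY∈Y (suc q))) (disjoint _ (fX∈X p))
    ... | false | true  = contradiction (subst (_∈ Y) e (fY∈Y (suc p))) (disjoint _ (fX∈X q))
    ... | false | false = suc-injective (fY-injective e)
    pick-side : ∀ q → pick q ∈ side c q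
    pick-side q with below c q
    ... | true  = fX∈X q
    ... | false = fY∈Y (suc q)
    pick≢spare : ∀ q → pick q ≢ fY zero
    pick≢spare q with below c q
    ... | true  = λ e → disjoint _ (fX∈X q) (subst (_∈ Y) (sym e) (fY∈Y zero))
    ... | false = 0≢1+n ∘ sym ∘ fY-injective
    tail₀ : Vec (Fin n) m
    tail₀ = tabulate pick
    admissible₀ : Admissible c tail₀
    admissible₀ = admissible
      (λ {p} {q} e → pick-injective (trans (sym (lookup∘tabulate pick p)) (trans e (lookup∘tabulate pick q))))
      λ q → subst (_∈ side c q) (sym (lookup∘tabulate pick q)) (pick-side q)
    spare-new₀ : fY zero ∉ setOf tail₀
    spare-new₀ spare∈ with ∈setOf⁻ tail₀ spare∈
    ... | q , e = pick≢spare q (trans (sym (lookup∘tabulate pick q)) e)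

module Colours {r k : ℕ} .{{_ : NonZero r}} (R : Representatives r k) where

  open Representatives R using (Γ; maximal)

  infix 4 _≈_
  _≈_ : Color R → Color R → Set
  _≈_ = _≈ᶜ_ R

  subgroup : ∀ j → IsSubgroup (Γ j)
  subgroup j = proj₁ (proj₁ (maximal j))

  ≈-refl : ∀ {a} → a ≈ a
  ≈-refl {j , σ} =
    refl , IsSubgroup.resp (subgroup j) (λ _ → sym (inverseˡ σ)) (IsSubgroup.id∈ (subgroup j))

  ≈-trans : ∀ {a b c} → a ≈ b → b ≈ c → a ≈ c
  ≈-trans {j , σ} {_ , τ} {_ , ρ} (refl , g) (refl , h) =
    refl , IsSubgroup.resp (subgroup j) (λ _ → cong (σ ⟨$⟩ˡ_) (inverseʳ τ)) (IsSubgroup.·∈ (subgroup j) g h)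

module ColouredEdges {r k n : ℕ} .{{_ : NonZero r}} (R : Representatives r k) (H : Graph r n)
  (χ : Coloring R H) (accordant : IsAccordant R H χ) where

  open Colours R
  open Representatives R using (Γ)

  SameColour : Vec (Fin n) r → Vec (Fin n) r → Set
  SameColour x y = ∀ e f → χ x e ≈ χ y f

  sameColour-refl : ∀ {x} → SameColour x x
  sameColour-refl {x} e f = subst (λ f → χ x e ≈ χ x f) (T-irrelevant e f) (≈-refl {χ x e})

  sameColour-trans : ∀ {x y z} → IsEdge H (setOf y) → SameColour x y → SameColour y z → SameColour x z
  sameColour-trans {x} {y} {z} e x~y y~z ex ez = ≈-trans {χ x ex} {χ y e} {χ z ez} (x~y ex e) (y~z e ez)

  sameColour-agreeing : ∀ {x y} j → (∀ q → q ≢ j → lookup x q ≡ lookup y q) → SameColour x y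
  sameColour-agreeing {x} {y} j agree with lookup x j ≟ lookup y j
  ... | no differ = λ e f → accordant x y e f (j , differ , agree)
  ... | yes same  = subst (SameColour x) (Pointwise-≡⇒≡ (ext everywhere)) sameColour-refl
    where
    everywhere : ∀ q → lookup x q ≡ lookup y q
    everywhere q with q ≟ j
    ... | yes refl = same
    ... | no q≢j   = agree q q≢j

  sameColour-act⇒Γ : IsOrientedColoring R H χ → ∀ {x} π (e : IsEdge H (setOf x)) → SameColour x (act π x)
    → Γ (proj₁ (χ x e)) ((proj₂ (χ x e) ⁻¹) · (π · proj₂ (χ x e)))
  sameColour-act⇒Γ oriented {x} π e same =
    proj₂ (≈-trans {χ x e} {χ (act π x) e′} {_•_ R π (χ x e)} (same e e′) (oriented π x e e′))
    where
    e′ : IsEdge H (setOf (act π x))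
    e′ = subst (IsEdge H) (sym (setOf-act π x)) e

module Linking {m n k : ℕ} (R : Representatives (suc m) k) (H : Graph (suc m) n)
  (χ : Coloring R H) (accordant : IsAccordant R H χ)
  (X Y : Subset n) (disjoint : ∀ v → v ∈ X → v ∉ Y) (c : ℕ) (c<m : c < m)
  (majority : ∀ W → W ⊆ X ∪ Y → ∣ W ∩ X ∣ ≡ c → ∣ W ∩ Y ∣ ≡ m ∸ c
            → ∣ X ∣ < 2 * ∣ (X ─ W) ∩ extenders H W ∣) where

  open Representatives R using (Γ)
  open ColouredEdges R H χ accordant
  open Extensions H X Y disjoint c (<⇒≤ c<m) majority

  Linked : Vec (Fin n) m → Vec (Fin n) m → Set
  Linked g g′ = ∀ p p′ → SameColour (p ∷ g) (p′ ∷ g′)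

  same-tail : ∀ {p p′ g} → SameColour (p ∷ g) (p′ ∷ g)
  same-tail = sameColour-agreeing zero λ { zero 0≢0 → contradiction refl 0≢0 ; (suc _) _ → refl }

  linked-trans : ∀ {g₁ g g₂} → Admissible c g → Linked g₁ g → Linked g g₂ → Linked g₁ g₂
  linked-trans {g = g} adm g₁~g g~g₂ p p′ =
    let v , v∈ = extension adm in sameColour-trans (extension-edge g v∈) (g₁~g p v) (g~g₂ v p′)

  linked-update : ∀ {g a v} → Admissible c g → Admissible c (g [ a ]≔ v) → Linked g (g [ a ]≔ v)
  -- A common extension w takes p ∷ g to w ∷ g, w ∷ g′ and p′ ∷ g′, changing one entry at a time.
  linked-update {g} {a} {v} adm adm′ p p′ =
    let w , w∈ , w∈′ = common-extension adm adm′ in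
    sameColour-trans (extension-edge g w∈) same-tail
      (sameColour-trans (extension-edge (g [ a ]≔ v) w∈′) (sameColour-agreeing (suc a) (off-a w)) same-tail)
    where
    off-a : ∀ w q → q ≢ suc a → lookup (w ∷ g) q ≡ lookup (w ∷ (g [ a ]≔ v)) q
    off-a w zero    _   = refl
    off-a w (suc q) q≢a = sym (lookup∘update′ (q≢a ∘ cong suc) g v)

  head-swap : ∀ {g p b} → Admissible c g → p ∈ side c b → p ∉ setOf g
    → SameColour (p ∷ g) (act (transpose zero (suc b)) (p ∷ g))
  head-swap {g} {p} {b} adm p∈ p-new = subst (SameColour (p ∷ g)) (sym (act-transpose-head p g b))
    (linked-update {a = b} adm (admissible-update adm p∈ (λ q _ → ∉setOf⇒≢ g p-new q)) p (lookup g b))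

  tail-swap : ∀ {g p z a b} → Admissible c g → side c a ≡ side c b → z ∈ side c a → z ∉ setOf g
    → SameColour (p ∷ g) (act (transpose (suc a) (suc b)) (p ∷ g))
  -- The entries at a and b are exchanged in three single-entry moves, position a first taking the spare z.
  tail-swap {g} {p} {z} {a} {b} adm@(admissible distinct sides) same-side z∈ z-new =
    subst (SameColour (p ∷ g)) (sym (act-transpose-tail p z g a b))
      (linked-trans adm₁ (linked-update adm adm₁)
        (linked-trans adm₂ (linked-update adm₁ adm₂) (linked-update adm₂ adm₃)) p p)
    where
    g₁ = g [ a ]≔ z
    g₂ = g₁ [ b ]≔ lookup g a
    adm₁ : Admissible c g₁
    adm₁ = admissible-update {a = a} adm z∈ (λ q _ → ∉setOf⇒≢ g z-new q)
    new-at-b : ∀ q → q ≢ b → lookup g₁ q ≢ lookup g a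
    new-at-b q _ with lookup-update g a z q
    ... | inj₁ (refl , e) = λ e′ → ∉setOf⇒≢ g z-new q (trans (sym e′) e)
    ... | inj₂ (q≢a , e)  = λ e′ → q≢a (distinct (trans (sym e) e′))
    adm₂ : Admissible c g₂
    adm₂ = admissible-update adm₁ (subst (lookup g a ∈_) same-side (sides a)) new-at-b
    new-at-a : ∀ q → q ≢ a → lookup g₂ q ≢ lookup g b
    new-at-a q q≢a with lookup-update g₁ b (lookup g a) q
    ... | inj₁ (refl , e) = λ e′ → q≢a (sym (distinct (trans (sym e) e′)))
    ... | inj₂ (q≢b , e)  = λ e′ → q≢b (distinct (trans (sym (trans e (lookup∘update′ q≢a g z))) e′))
    adm₃ : Admissible c (g₂ [ a ]≔ lookup g b)
    adm₃ = admissible-update adm₂ (subst (lookup g b ∈_) (sym same-side) (sides b)) new-at-a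

  module BaseColour (oriented : IsOrientedColoring R H χ) (m≤∣X∣ : m ≤ ∣ X ∣) (r≤∣Y∣ : suc m ≤ ∣ Y ∣) where

    open Base (base m≤∣X∣ r≤∣Y∣)

    x₀ : Vec (Fin n) (suc m)
    x₀ = head ∷ tail

    edge : IsEdge H (setOf x₀)
    edge = extension-edge tail extends

    J : Fin (Representatives.m R)
    J = proj₁ (χ x₀ edge)

    σ : Perm (suc m)
    σ = proj₂ (χ x₀ edge)

    used : Used R H χ J
    used = x₀ , edge , refl

    preserved : ∀ {A} → (∀ π → Γ J π ⇔ Preserves A π) → ∀ π → SameColour x₀ (act π x₀)
      → Preserves (A ∘ (σ ⟨$⟩ˡ_)) π
    preserved {A} Γ⇔A π same = Equivalence.to (preserves-conj A (σ ⁻¹) π)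
      (Equivalence.to (Γ⇔A _) (sameColour-act⇒Γ oriented π edge same))

    blocks-refine : ∀ {A} → (∀ π → Γ J π ⇔ Preserves A π) → Refines (below (suc c)) (A ∘ (σ ⟨$⟩ˡ_))
    blocks-refine {A} Γ⇔A = blockwise-constant⇒refines c y X-block Y-block
      where
      B = A ∘ (σ ⟨$⟩ˡ_)
      y = fromℕ< c<m
      y-side : side c y ≡ Y
      y-side = side-above c y (below-fromℕ< c<m)
      X-block : ∀ b → below c b ≡ true → B (suc b) ≡ B zero
      X-block b b-below = preserves-transpose {A = B} zero (suc b)
        (preserved Γ⇔A (transpose zero (suc b)) (head-swap tail-admissible
          (subst (head ∈_) (sym (side-below c b b-below)) (extensions⊆X tail extends))
          (extension-new tail extends)))
      Y-block : ∀ b → below c b ≡ false → B (suc b) ≡ B (suc y)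
      Y-block b b-above = preserves-transpose {A = B} (suc y) (suc b)
        (preserved Γ⇔A (transpose (suc y) (suc b)) (tail-swap tail-admissible
          (trans y-side (sym (side-above c b b-above)))
          (subst (spare ∈_) (sym y-side) spare∈Y)
          spare-new))

    colour-conjugate : ∀ {t} → 1 ≤ t → t < suc m → Conjugate (Γ J) (SymProd t)
      → Conjugate (Γ J) (SymProd (suc c))
    colour-conjugate 1≤t t<r Γ~SymProd =
      let A , A-nonconstant , Γ⇔A = conjugate-symProd⇒stabiliser {Γ = Γ J} 1≤t t<r Γ~SymProd
      in stabiliser-conjugate A σ Γ⇔A
           (preserves⇔symProd {B = A ∘ (σ ⟨$⟩ˡ_)} (blocks-refine Γ⇔A) (nonconstant-∘ σ A-nonconstant))

lemma13 : (r : ℕ) .{{_ : NonZero r}} → 2 ≤ r → (k : ℕ) (R : Representatives r k)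
    → (n : ℕ) (H : Graph r n) → ¬ ContainsCycleHom k H
    → (χ : Coloring R H) → IsOrientedColoring R H χ → IsAccordant R H χ
    → (∀ j → Used R H χ j → ∃[ t ] (1 ≤ t × t < r × Conjugate (Representatives.Γ R j) (SymProd t)))
    → (X Y : Subset n) → (∀ v → v ∈ X → v ∉ Y) → r ≤ ∣ X ∣ → r ≤ ∣ Y ∣
    → (i : ℕ) → 1 ≤ i → i < r
    → (∀ W → W ⊆ X ∪ Y → ∣ W ∩ X ∣ ≡ i ∸ 1 → ∣ W ∩ Y ∣ ≡ r ∸ i
         → ∣ X ∣ < 2 * ∣ (X ─ W) ∩ extenders H W ∣)
    → ∃[ j ] (Used R H χ j × Conjugate (Representatives.Γ R j) (SymProd i))
lemma13 zero () _ _ _ _ _ _ _ _ _ _ _ _ _ _ _ _ _ _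
lemma13 (suc m) _ _ _ _ _ _ _ _ _ _ _ _ _ _ _ zero () _ _
lemma13 (suc m) _ k R n H _ χ oriented accordant colours-conjugate X Y disjoint r≤∣X∣ r≤∣Y∣
  (suc c) _ (s≤s c<m) majority =
  let open Linking R H χ accordant X Y disjoint c c<m majority
      open BaseColour oriented (≤-trans (n≤1+n m) r≤∣X∣) r≤∣Y∣
      t , 1≤t , t<r , Γ~SymProd = colours-conjugate J used
  in J , used , colour-conjugate 1≤t t<r Γ~SymProd
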